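{- Let $G$ be a finite digraph with vertex set $V$, let $t\ge 1$ be the activation threshold, and let $S\subseteq V$ with $|S|=s$. (a) Suppose $s\ge t$. Then $G$ cannot be synchronized starting from $S$ (with threshold $t$) if and only if there exists a set $A$ of vertices acquired from $S$, with $S\subseteq A\neq V$, such that $\mathrm{id}_A x<t$ for all $x\in V\setminus A$. (b) Suppose moreover that $G$ is regular of degree $h$ with $h\ge t$ and $s\ge t$. Then $G$ cannot be synchronized starting from $S$ if and only if there exists a set $A$ of vertices acquired from $S$, with $S\subseteq A\neq V$, such that $\mathrm{id}_{V\setminus A}\, x>h-t$ for all $x\in V\setminus A$.
   Context: Activation process: given a digraph $G$ with vertex set $V$, a set $S\subseteq V$ of initially active vertices and a natural number $t$ (the threshold), put $S_0=S$ and for $i\ge1$ let $S_i=S_{i-1}\cup\{v\in V\setminus S_{i-1}: v \text{ has at least } t \text{ edges } (u,v) \text{ with } u\in S_{i-1}\}$. A vertex $x$ is acquired from $S$ if $x\in S_i$ for some $i\ge 0$. $G$ is synchronized (brought to synchrony) starting from $S$ if $S_i=V$ for some $i$. For $U\subseteq V$ and a vertex $x$, $\mathrm{id}_U x$ denotes the number of edges that originate in $U$ and point to $x$. A digraph is regular of degree $h$ if every vertex has in-degree $h$ and out-degree $h$. -}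

module Defs where

open import Data.Nat using (ℕ; zero; suc; _≤ᵇ_)
open import Data.Bool using (Bool)
open import Data.Fin using (Fin)
open import Data.Fin.Subset using (Subset; _∈_; _∩_; _∪_; ∣_∣; ⊤)
open import Data.Vec using (tabulate)
open import Data.Product using (∃)
open import Relation.Binary.PropositionalEquality using (_≡_)

-- A finite digraph on vertex set Fin n: E u v = true iff there is an edge (u , v).
Digraph : ℕ → Set
Digraph n = Fin n → Fin n → Bool

inNbrs : ∀ {n} → Digraph n → Fin n → Subset n
inNbrs E x = tabulate (λ u → E u x)

outNbrs : ∀ {n} → Digraph n → Fin n → Subset n
outNbrs E x = tabulate (λ v → E x v)

idIn : ∀ {n} → Digraph n → Subset n → Fin n → ℕ
idIn E U x = ∣ U ∩ inNbrs E x ∣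

step : ∀ {n} → Digraph n → ℕ → Subset n → Subset n
step E t S = S ∪ tabulate (λ v → t ≤ᵇ idIn E S v)

activated : ∀ {n} → Digraph n → ℕ → Subset n → ℕ → Subset n
activated E t S zero    = S
activated E t S (suc i) = step E t (activated E t S i)

Acquired : ∀ {n} → Digraph n → ℕ → Subset n → Fin n → Set
Acquired E t S x = ∃ λ i → x ∈ activated E t S i

Synchronized : ∀ {n} → Digraph n → ℕ → Subset n → Set
Synchronized E t S = ∃ λ i → activated E t S i ≡ ⊤

Regular : ∀ {n} → Digraph n → ℕ → Set
Regular E h = ∀ v → ∣ inNbrs E v ∣ ≡ h × ∣ outNbrs E v ∣ ≡ h
  where open import Data.Product using (_×_)

-- The activation sequence S₀ ⊆ S₁ ⊆ … is an increasing chain in the finite lattice of vertex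
-- sets, so it reaches a fixed point A = S_j.  A set A ⊇ S is a fixed point of the step exactly
-- when every vertex outside A has fewer than t in-edges from A, and every S_i lies inside
-- every such A; hence G fails to synchronize iff some such A ≠ V is acquired from S.
-- In a regular digraph of degree h ≥ t, id_A x + id_{V∖A} x = h turns id_A x < t into
-- id_{V∖A} x > h − t.
module Submission where

open import Defs
open import Data.Nat using (ℕ; zero; suc; _+_; _∸_; _≤_; _<_; _>_; _≤?_; z≤n; s≤s)
open import Data.Nat.Properties
  using (≤ᵇ⇒≤; ≤⇒≤ᵇ; ≤-trans; ≤-<-trans; ≰⇒>; <⇒≱; m∸n≤m; m≤n+m; +-suc)
open import Data.Bool using (Bool; true; false; T)
open import Data.Unit using (tt)
open import Data.Empty using (⊥-elim)
open import Data.Fin using (Fin)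
open import Data.Fin.Subset using (Subset; _∈_; _∉_; _⊆_; _∩_; ∣_∣; ⊤; ∁)
open import Data.Fin.Subset.Properties
  using (p⊆p∪q; x∈p∪q⁺; x∈p∪q⁻; x∈p∩q⁺; x∈p∩q⁻; _∈?_; _⊂?_; p⊂q⇒∣p∣<∣q∣; p⊆q⇒∣p∣≤∣q∣;
         ∣p∣≤n; ⊆-antisym; ⊆⊤; ∈⊤)
open import Data.Vec using ([]; _∷_; tabulate)
open import Data.Vec.Properties using (lookup∘tabulate; lookup⇒[]=; []=⇒lookup)
open import Data.Product using (Σ; ∃; _×_; _,_; proj₁)
open import Data.Sum using (_⊎_; inj₁; inj₂)
open import Relation.Nullary using (¬_; yes; no)
open import Relation.Binary.PropositionalEquality using (_≡_; refl; sym; trans; subst; cong)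
open import Function.Bundles using (_⇔_; mk⇔; Equivalence)
open import Function.Properties.Equivalence using () renaming (trans to ⇔-trans)

∈-tabulate⁺ : ∀ {n} (f : Fin n → Bool) x → T (f x) → x ∈ tabulate f
∈-tabulate⁺ f x fx with f x in eq
... | true = lookup⇒[]= x (tabulate f) (trans (lookup∘tabulate f x) eq)

∈-tabulate⁻ : ∀ {n} (f : Fin n → Bool) x → x ∈ tabulate f → T (f x)
∈-tabulate⁻ f x x∈ rewrite sym (lookup∘tabulate f x) | []=⇒lookup x∈ = tt

∣p∩q∣+∣∁p∩q∣≡∣q∣ : ∀ {n} (p q : Subset n) → ∣ p ∩ q ∣ + ∣ ∁ p ∩ q ∣ ≡ ∣ q ∣
∣p∩q∣+∣∁p∩q∣≡∣q∣ []          []          = refl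
∣p∩q∣+∣∁p∩q∣≡∣q∣ (true  ∷ p) (true  ∷ q) = cong suc (∣p∩q∣+∣∁p∩q∣≡∣q∣ p q)
∣p∩q∣+∣∁p∩q∣≡∣q∣ (true  ∷ p) (false ∷ q) = ∣p∩q∣+∣∁p∩q∣≡∣q∣ p q
∣p∩q∣+∣∁p∩q∣≡∣q∣ (false ∷ p) (true  ∷ q) = trans (+-suc _ _) (cong suc (∣p∩q∣+∣∁p∩q∣≡∣q∣ p q))
∣p∩q∣+∣∁p∩q∣≡∣q∣ (false ∷ p) (false ∷ q) = ∣p∩q∣+∣∁p∩q∣≡∣q∣ p q

m<o⇒m+n∸o<n : ∀ a c t → a < t → t ≤ a + c → a + c ∸ t < c
m<o⇒m+n∸o<n zero    (suc c) (suc t) _         (s≤s _)   = s≤s (m∸n≤m c t)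
m<o⇒m+n∸o<n (suc a) c       (suc t) (s≤s a<t) (s≤s t≤) = m<o⇒m+n∸o<n a c t a<t t≤

o≤m⇒n≤m+n∸o : ∀ a c t → t ≤ a → c ≤ a + c ∸ t
o≤m⇒n≤m+n∸o a       c zero    _         = m≤n+m c a
o≤m⇒n≤m+n∸o (suc a) c (suc t) (s≤s t≤a) = o≤m⇒n≤m+n∸o a c t t≤a

m<o⇔m+n∸o<n : ∀ a c t → t ≤ a + c → a < t ⇔ a + c ∸ t < c
m<o⇔m+n∸o<n a c t t≤ = mk⇔ (λ a<t → m<o⇒m+n∸o<n a c t a<t t≤) from
  where
  from : a + c ∸ t < c → a < t
  from lt with t ≤? a
  ... | yes t≤a = ⊥-elim (<⇒≱ lt (o≤m⇒n≤m+n∸o a c t t≤a))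
  ... | no  t≰a = ≰⇒> t≰a

module _ {n} (f : ℕ → Subset n) (increasing : ∀ i → f i ⊆ f (suc i)) where

  private
    stabilises-or-grows : ∀ i → (∃ λ j → f (suc j) ⊆ f j) ⊎ i ≤ ∣ f i ∣
    stabilises-or-grows zero = inj₂ z≤n
    stabilises-or-grows (suc i) with stabilises-or-grows i
    ... | inj₁ stable = inj₁ stable
    ... | inj₂ i≤ with f i ⊂? f (suc i)
    ...   | yes f⊂ = inj₂ (≤-<-trans i≤ (p⊂q⇒∣p∣<∣q∣ f⊂))
    ...   | no  f⊄ = inj₁ (i , λ {x} → shrinks x)
      where
      shrinks : ∀ x → x ∈ f (suc i) → x ∈ f i
      shrinks x x∈ with x ∈? f i
      ... | yes x∈f = x∈f
      ... | no  x∉f = ⊥-elim (f⊄ (increasing i , x , x∈ , x∉f))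

  increasing-chain-stabilises : ∃ λ j → f (suc j) ⊆ f j
  increasing-chain-stabilises with stabilises-or-grows (suc n)
  ... | inj₁ stable = stable
  ... | inj₂ n<     = ⊥-elim (<⇒≱ (s≤s (∣p∣≤n (f (suc n)))) n<)

module Activation {n} (E : Digraph n) (t : ℕ) where

  Closed : Subset n → Set
  Closed A = ∀ x → x ∉ A → idIn E A x < t

  AcquiredSetWith : (Subset n → Set) → Subset n → Set
  AcquiredSetWith P S =
    Σ (Subset n) (λ A → (∀ x → x ∈ A → Acquired E t S x) × S ⊆ A × (¬ (A ≡ ⊤)) × P A)

  AcquiredSetWith-map : ∀ {P Q} → (∀ A → P A → Q A) → ∀ S → AcquiredSetWith P S → AcquiredSetWith Q S
  AcquiredSetWith-map P⇒Q S (A , acquired , S⊆A , A≢⊤ , PA) = A , acquired , S⊆A , A≢⊤ , P⇒Q A PA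

  AcquiredSetWith-cong : ∀ {P Q} → (∀ A → P A ⇔ Q A) → ∀ S → AcquiredSetWith P S ⇔ AcquiredSetWith Q S
  AcquiredSetWith-cong P⇔Q S = mk⇔ (AcquiredSetWith-map (λ A → Equivalence.to (P⇔Q A)) S)
                                   (AcquiredSetWith-map (λ A → Equivalence.from (P⇔Q A)) S)

  ∈-step-new : ∀ {A x} → t ≤ idIn E A x → x ∈ step E t A
  ∈-step-new t≤ = x∈p∪q⁺ (inj₂ (∈-tabulate⁺ _ _ (≤⇒≤ᵇ t≤)))

  ∈-step⁻ : ∀ {A x} → x ∈ step E t A → x ∈ A ⊎ t ≤ idIn E A x
  ∈-step⁻ {A} {x} x∈ with x∈p∪q⁻ A _ x∈
  ... | inj₁ x∈A  = inj₁ x∈A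
  ... | inj₂ x∈new = inj₂ (≤ᵇ⇒≤ t _ (∈-tabulate⁻ _ x x∈new))

  idIn-mono : ∀ {A B} → A ⊆ B → ∀ x → idIn E A x ≤ idIn E B x
  idIn-mono A⊆B x = p⊆q⇒∣p∣≤∣q∣ λ y∈ → let (y∈A , y→x) = x∈p∩q⁻ _ _ y∈ in x∈p∩q⁺ (A⊆B y∈A , y→x)

  step-⊆⇒closed : ∀ A → step E t A ⊆ A → Closed A
  step-⊆⇒closed A stepA⊆A x x∉A with t ≤? idIn E A x
  ... | yes t≤ = ⊥-elim (x∉A (stepA⊆A (∈-step-new t≤)))
  ... | no  t≰ = ≰⇒> t≰

  closed⇒step-⊆ : ∀ {A B} → Closed B → A ⊆ B → step E t A ⊆ B
  closed⇒step-⊆ {A} {B} closed A⊆B {x} x∈ with ∈-step⁻ x∈ | x ∈? B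
  ... | inj₁ x∈A | _       = A⊆B x∈A
  ... | inj₂ _   | yes x∈B = x∈B
  ... | inj₂ t≤  | no  x∉B = ⊥-elim (<⇒≱ (closed x x∉B) (≤-trans t≤ (idIn-mono A⊆B x)))

  activated-⊆-closed : ∀ {S A} → Closed A → S ⊆ A → ∀ i → activated E t S i ⊆ A
  activated-⊆-closed closed S⊆A zero    = S⊆A
  activated-⊆-closed closed S⊆A (suc i) = closed⇒step-⊆ closed (activated-⊆-closed closed S⊆A i)

  S⊆activated : ∀ S i → S ⊆ activated E t S i
  S⊆activated S zero    x∈ = x∈
  S⊆activated S (suc i) x∈ = p⊆p∪q _ (S⊆activated S i x∈)

  ¬synchronized⇔closed-acquired-set : ∀ S → (¬ Synchronized E t S) ⇔ AcquiredSetWith Closed S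
  ¬synchronized⇔closed-acquired-set S = mk⇔ to from
    where
    to : ¬ Synchronized E t S → AcquiredSetWith Closed S
    to ¬sync =
      let (j , stable) = increasing-chain-stabilises (activated E t S) (λ i → p⊆p∪q _) in
      activated E t S j , (λ x x∈ → j , x∈) , S⊆activated S j , (λ eq → ¬sync (j , eq)) ,
      step-⊆⇒closed _ stable
    from : AcquiredSetWith Closed S → ¬ Synchronized E t S
    from (A , _ , S⊆A , A≢⊤ , closed) (i , Sᵢ≡⊤) =
      A≢⊤ (⊆-antisym ⊆⊤ λ {x} _ → activated-⊆-closed closed S⊆A i (subst (x ∈_) (sym Sᵢ≡⊤) ∈⊤))

  module _ {h} (regular : Regular E h) (t≤h : t ≤ h) where

    idIn+idIn-∁≡degree : ∀ A x → idIn E A x + idIn E (∁ A) x ≡ h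
    idIn+idIn-∁≡degree A x = trans (∣p∩q∣+∣∁p∩q∣≡∣q∣ A (inNbrs E x)) (proj₁ (regular x))

    idIn<⇔idIn-∁> : ∀ A x → idIn E A x < t ⇔ idIn E (∁ A) x > h ∸ t
    idIn<⇔idIn-∁> A x rewrite sym (idIn+idIn-∁≡degree A x) = m<o⇔m+n∸o<n _ _ t t≤h

    closed⇔∁-dense : ∀ A → Closed A ⇔ (∀ x → x ∉ A → idIn E (∁ A) x > h ∸ t)
    closed⇔∁-dense A = mk⇔ (λ closed x x∉A → Equivalence.to (idIn<⇔idIn-∁> A x) (closed x x∉A))
                           (λ dense x x∉A → Equivalence.from (idIn<⇔idIn-∁> A x) (dense x x∉A))

theorem1 : ∀ {n} (E : Digraph n) (t : ℕ) (S : Subset n) → 1 ≤ t →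
    ((t ≤ ∣ S ∣ →
      ((¬ Synchronized E t S) ⇔
        Σ (Subset n) (λ A → (∀ x → x ∈ A → Acquired E t S x) × S ⊆ A × (¬ (A ≡ ⊤))
          × (∀ x → x ∉ A → idIn E A x < t))))
    × (∀ h → Regular E h → t ≤ h → t ≤ ∣ S ∣ →
      ((¬ Synchronized E t S) ⇔
        Σ (Subset n) (λ A → (∀ x → x ∈ A → Acquired E t S x) × S ⊆ A × (¬ (A ≡ ⊤))
          × (∀ x → x ∉ A → idIn E (∁ A) x > h ∸ t)))))
theorem1 E t S _ =
  (λ _ → ¬synchronized⇔closed-acquired-set S) ,
  (λ h regular t≤h _ → ⇔-trans (¬synchronized⇔closed-acquired-set S)
    (AcquiredSetWith-cong (closed⇔∁-dense regular t≤h) S))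
  where open Activation E t
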